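{- For integers $j,m$ with $m\ge 0$ and $m\le j$, let $d_{j,m}={}_{2}F_{1}\!\left(\begin{smallmatrix}-m,\ -j+m-1\\ -j\end{smallmatrix}\big|-4\right)$. Then for all integers $j\ge 2$ and $1\le m\le\lfloor j/2\rfloor$, \[ 4\binom{j-2}{m-1}(j-2m+1)(j-m+1)\,d_{j-2,m-1}+\binom{j-1}{m-1}(j-2m+2)(j-m)\,d_{j-1,m-1} +\binom{j-1}{m}(j-2m)(j-m+1)\,d_{j-1,m}-\binom{j}{m}(j-m)(j-2m+1)\,d_{j,m}=0. \]
   Context: For a nonnegative integer $m$, the terminating hypergeometric series is ${}_2F_1\!\left(\begin{smallmatrix}-m,\ b\\ c\end{smallmatrix}\big|z\right)=\sum_{k=0}^{m}\frac{(-m)_k(b)_k}{(c)_k\,k!}z^k$, where $(a)_k=a(a+1)\cdots(a+k-1)$ is the Pochhammer symbol. -}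

module Defs where

open import Data.Nat using (ℕ; zero; suc)
open import Data.Nat.Combinatorics using (_C_)
open import Data.Integer using (ℤ; +_; -[1+_])
import Data.Integer as ℤ
open import Data.Rational using (ℚ; 0ℚ; 1ℚ; _+_; _*_; _/_; _÷_; ≢-nonZero)
open import Data.Rational.Properties using (_≟_)
open import Relation.Nullary using (yes; no)

ℤ→ℚ : ℤ → ℚ
ℤ→ℚ z = z / 1

ℕ→ℚ : ℕ → ℚ
ℕ→ℚ n = (+ n) / 1

-- total division on ℚ (convention: x / 0 = 0); only ever applied to
-- nonzero denominators in the statement below
_÷'_ : ℚ → ℚ → ℚ
p ÷' q with q ≟ 0ℚ
... | yes _ = 0ℚ
... | no q≢0 = _÷_ p q {{≢-nonZero q≢0}}

poch : ℚ → ℕ → ℚ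
poch a zero = 1ℚ
poch a (suc k) = poch a k * (a + ℕ→ℚ k)

_^'_ : ℚ → ℕ → ℚ
x ^' zero = 1ℚ
x ^' suc k = (x ^' k) * x

fact : ℕ → ℚ
fact zero = 1ℚ
fact (suc k) = fact k * ℕ→ℚ (suc k)

sumTo : ℕ → (ℕ → ℚ) → ℚ
sumTo zero f = f 0
sumTo (suc n) f = sumTo n f + f (suc n)

-- terminating 2F1(-m, b; c | z) = Σ_{k=0}^{m} (-m)_k (b)_k / ((c)_k k!) z^k
F21 : ℕ → ℚ → ℚ → ℚ → ℚ
F21 m b c z = sumTo m (λ k →
  ((poch (ℤ→ℚ (ℤ.- (+ m))) k * poch b k) ÷' (poch c k * fact k)) * (z ^' k))

d : ℕ → ℕ → ℚ
d j m = F21 m (ℤ→ℚ ((ℤ.- (+ j)) ℤ.+ (+ m) ℤ.- (+ 1))) (ℤ→ℚ (ℤ.- (+ j))) (ℤ→ℚ -[1+ 3 ])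

{-# OPTIONS --safe #-}
module Submission where

-- Write j = m + n and D n m = C(m+n, m) d_{m+n,m}.  The signs of (-m)_k, (-n-1)_k, (-m-n)_k and
-- (-4)^k cancel, so D n m = Σ_{k ≤ m} 4^k C(m-k+n, m-k) C(n+1, k) is a natural number and the
-- theorem becomes a linear recurrence between four values of D.  It is proved by creative
-- telescoping: with p = m + s and n = p + 1, the certificate
--   G(k) = (n+1)(s+1) 4^k C(n, k-1) C(m+1-k+p, m+1-k)
-- turns the k-th summand of the recurrence into G(k+1) - G(k), and checking this needs only the
-- ratios of consecutive binomial coefficients.

module Binomials where
  open import Data.Nat
  open import Data.Nat.Properties
  open import Data.Nat.Combinatorics using (_C_; nC1≡n; nCk+nC[k+1]≡[n+1]C[k+1])
  open import Data.Nat.Tactic.RingSolver using (solve-∀)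
  open import Relation.Binary.PropositionalEquality
  open ≡-Reasoning

  [1+k]*[1+n]C[1+k]≡[1+n]*nCk : ∀ n k → suc k * (suc n C suc k) ≡ suc n * (n C k)
  [1+k]*[1+n]C[1+k]≡[1+n]*nCk zero    zero    = refl
  [1+k]*[1+n]C[1+k]≡[1+n]*nCk zero    (suc k) = *-zeroʳ (suc (suc k))
  [1+k]*[1+n]C[1+k]≡[1+n]*nCk (suc n) zero    = begin
    1 * (suc (suc n) C 1) ≡⟨ *-identityˡ _ ⟩
    suc (suc n) C 1       ≡⟨ nC1≡n (suc (suc n)) ⟩
    suc (suc n)           ≡⟨ *-identityʳ (suc (suc n)) ⟨
    suc (suc n) * 1       ∎
  [1+k]*[1+n]C[1+k]≡[1+n]*nCk (suc n) (suc k) = begin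
    suc (suc k) * (suc (suc n) C suc (suc k))
      ≡⟨ cong (suc (suc k) *_) (nCk+nC[k+1]≡[n+1]C[k+1] (suc n) (suc k)) ⟨
    suc (suc k) * (a + b)
      ≡⟨ expand (suc k) a b ⟩
    a + suc k * a + suc (suc k) * b
      ≡⟨ cong₂ (λ x y → a + x + y) ([1+k]*[1+n]C[1+k]≡[1+n]*nCk n k) ([1+k]*[1+n]C[1+k]≡[1+n]*nCk n (suc k)) ⟩
    a + suc n * (n C k) + suc n * (n C suc k)
      ≡⟨ cong (λ t → t + suc n * (n C k) + suc n * (n C suc k)) (nCk+nC[k+1]≡[n+1]C[k+1] n k) ⟨
    (n C k + n C suc k) + suc n * (n C k) + suc n * (n C suc k)
      ≡⟨ collect (suc n) (n C k) (n C suc k) ⟩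
    suc (suc n) * (n C k + n C suc k)
      ≡⟨ cong (suc (suc n) *_) (nCk+nC[k+1]≡[n+1]C[k+1] n k) ⟩
    suc (suc n) * (suc n C suc k) ∎
    where
    a = suc n C suc k
    b = suc n C suc (suc k)
    expand : ∀ x y z → suc x * (y + z) ≡ y + x * y + suc x * z
    expand = solve-∀
    collect : ∀ x u v → (u + v) + x * u + x * v ≡ suc x * (u + v)
    collect = solve-∀

  [1+k]*[k+c]C[1+k]≡c*[k+c]Ck : ∀ k c → suc k * ((k + c) C suc k) ≡ c * ((k + c) C k)
  [1+k]*[k+c]C[1+k]≡c*[k+c]Ck k c = +-cancelˡ-≡ (suc k * x) _ _ (begin
    suc k * x + suc k * y   ≡⟨ *-distribˡ-+ (suc k) x y ⟨
    suc k * (x + y)         ≡⟨ cong (suc k *_) (nCk+nC[k+1]≡[n+1]C[k+1] (k + c) k) ⟩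
    suc k * (suc (k + c) C suc k) ≡⟨ [1+k]*[1+n]C[1+k]≡[1+n]*nCk (k + c) k ⟩
    suc (k + c) * x         ≡⟨ *-distribʳ-+ x (suc k) c ⟩
    suc k * x + c * x       ∎)
    where
    x = (k + c) C k
    y = (k + c) C suc k

  infixl 6.5 _C⁻_

  -- n C⁻ k = n C (k - 1), with the value 0 (not n C 0) at k = 0
  _C⁻_ : ℕ → ℕ → ℕ
  n C⁻ zero  = 0
  n C⁻ suc k = n C k

  [1+n]Ck≡nCk+nC⁻k : ∀ n k → suc n C k ≡ n C k + n C⁻ k
  [1+n]Ck≡nCk+nC⁻k n zero    = refl
  [1+n]Ck≡nCk+nC⁻k n (suc k) = trans (sym (nCk+nC[k+1]≡[n+1]C[k+1] n k)) (+-comm (n C k) (n C suc k))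

  k*[k+c]Ck≡[1+c]*[k+c]C⁻k : ∀ k c → k * ((k + c) C k) ≡ suc c * ((k + c) C⁻ k)
  k*[k+c]Ck≡[1+c]*[k+c]C⁻k zero    c = sym (*-zeroʳ (suc c))
  k*[k+c]Ck≡[1+c]*[k+c]C⁻k (suc k) c =
    subst (λ t → suc k * (t C suc k) ≡ suc c * (t C k)) (+-suc k c) ([1+k]*[k+c]C[1+k]≡c*[k+c]Ck k (suc c))

module Recurrence where
  open import Data.Nat
  open import Data.Nat.Properties
  open import Data.Nat.Combinatorics using (_C_; nCk+nC[k+1]≡[n+1]C[k+1])
  open import Data.Nat.Tactic.RingSolver using (solve-∀)
  open import Data.Product using (_,_)
  open import Relation.Binary.PropositionalEquality
  open ≡-Reasoning
  open import Algebra.Properties.CommutativeSemigroup +-commutativeSemigroup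
    using () renaming (interchange to +-interchange)
  open Binomials

  Σ≤ : ℕ → (ℕ → ℕ) → ℕ
  Σ≤ zero    f = f 0
  Σ≤ (suc n) f = Σ≤ n f + f (suc n)

  Σ≤-+ : ∀ n f g → Σ≤ n (λ k → f k + g k) ≡ Σ≤ n f + Σ≤ n g
  Σ≤-+ zero    f g = refl
  Σ≤-+ (suc n) f g = trans (cong (_+ (f (suc n) + g (suc n))) (Σ≤-+ n f g)) (+-interchange (Σ≤ n f) (Σ≤ n g) (f (suc n)) (g (suc n)))

  Σ≤-* : ∀ n c f → Σ≤ n (λ k → c * f k) ≡ c * Σ≤ n f
  Σ≤-* zero    c f = refl
  Σ≤-* (suc n) c f = trans (cong (_+ c * f (suc n)) (Σ≤-* n c f)) (sym (*-distribˡ-+ c _ _))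

  telescope : ∀ n (a b g : ℕ → ℕ) → (∀ k → k ≤ n → a k + g k ≡ b k + g (suc k)) →
              Σ≤ n a + g 0 ≡ Σ≤ n b + g (suc n)
  telescope zero    a b g step = step 0 z≤n
  telescope (suc n) a b g step = begin
    Σ≤ n a + a (suc n) + g 0         ≡⟨ swap (Σ≤ n a) (a (suc n)) (g 0) ⟩
    Σ≤ n a + g 0 + a (suc n)         ≡⟨ cong (_+ a (suc n)) (telescope n a b g (λ k k≤n → step k (m≤n⇒m≤1+n k≤n))) ⟩
    Σ≤ n b + g (suc n) + a (suc n)   ≡⟨ shift (Σ≤ n b) (g (suc n)) (a (suc n)) ⟩
    Σ≤ n b + (a (suc n) + g (suc n)) ≡⟨ cong (Σ≤ n b +_) (step (suc n) ≤-refl) ⟩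
    Σ≤ n b + (b (suc n) + g (2 + n)) ≡⟨ +-assoc (Σ≤ n b) _ _ ⟨
    Σ≤ n b + b (suc n) + g (2 + n)   ∎
    where
    swap : ∀ x y z → x + y + z ≡ x + z + y
    swap = solve-∀
    shift : ∀ x y z → x + y + z ≡ x + (z + y)
    shift = solve-∀

  term : ℕ → ℕ → ℕ → ℕ
  term n m k = 4 ^ k * ((m ∸ k + n) C (m ∸ k)) * (suc n C k)

  D : ℕ → ℕ → ℕ
  D n m = Σ≤ m (term n m)

  recurrenceLeft recurrenceRight certificate : ℕ → ℕ → ℕ → ℕ
  recurrenceLeft m s k =
    4 * suc s * suc (suc (m + s)) * term (m + s) m k + suc (suc s) * suc (m + s) * term (suc (m + s)) m k
      + s * suc (suc (m + s)) * term (m + s) (suc m) k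
  recurrenceRight m s k = suc (m + s) * suc s * term (suc (m + s)) (suc m) k
  certificate m s k =
    suc (suc (m + s)) * suc s * 4 ^ k * (suc (m + s) C⁻ k) * ((suc m ∸ k + (m + s)) C (suc m ∸ k))

  certificate-identity : ∀ k r s X Y W U V F →
    suc r * U ≡ suc (k + r + s) * V → k * Y ≡ suc (suc (r + s)) * W →
    4 * suc s * suc (suc (k + r + s)) * (F * X * Y) + suc (suc s) * suc (k + r + s) * (F * V * (Y + W))
      + s * suc (suc (k + r + s)) * (F * U * Y) + suc (suc (k + r + s)) * suc s * F * W * U
    ≡ suc (k + r + s) * suc s * (F * (V + U) * (Y + W)) + suc (suc (k + r + s)) * suc s * (4 * F) * Y * X
  certificate-identity k r s X Y W U V F hU hY =
    +-cancelʳ-≡ (F * (Y + W) * (suc r * U) + F * U * (k * Y)) _ _ (begin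
      lhs + (F * (Y + W) * (suc r * U) + F * U * (k * Y))
        ≡⟨ polynomial-identity k r s X Y W U V F ⟩
      rhs + (F * (Y + W) * (suc (k + r + s) * V) + F * U * (suc (suc (r + s)) * W))
        ≡⟨ cong (rhs +_) (cong₂ (λ u y → F * (Y + W) * u + F * U * y) hU hY) ⟨
      rhs + (F * (Y + W) * (suc r * U) + F * U * (k * Y)) ∎)
    where
    lhs rhs : ℕ
    lhs = 4 * suc s * suc (suc (k + r + s)) * (F * X * Y) + suc (suc s) * suc (k + r + s) * (F * V * (Y + W))
          + s * suc (suc (k + r + s)) * (F * U * Y) + suc (suc (k + r + s)) * suc s * F * W * U
    rhs = suc (k + r + s) * suc s * (F * (V + U) * (Y + W)) + suc (suc (k + r + s)) * suc s * (4 * F) * Y * X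
    polynomial-identity : ∀ k r s X Y W U V F →
      4 * suc s * suc (suc (k + r + s)) * (F * X * Y) + suc (suc s) * suc (k + r + s) * (F * V * (Y + W))
        + s * suc (suc (k + r + s)) * (F * U * Y) + suc (suc (k + r + s)) * suc s * F * W * U
        + (F * (Y + W) * (suc r * U) + F * U * (k * Y))
      ≡ suc (k + r + s) * suc s * (F * (V + U) * (Y + W)) + suc (suc (k + r + s)) * suc s * (4 * F) * Y * X
        + (F * (Y + W) * (suc (k + r + s) * V) + F * U * (suc (suc (r + s)) * W))
    polynomial-identity = solve-∀

  pascal-+-suc : ∀ r p → suc (r + suc p) C suc r ≡ (r + suc p) C r + suc (r + p) C suc r
  pascal-+-suc r p =
    trans (sym (nCk+nC[k+1]≡[n+1]C[k+1] (r + suc p) r)) (cong (λ t → (r + suc p) C r + t C suc r) (+-suc r p))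

  certificate-step : ∀ m s k → k ≤ m →
    recurrenceLeft m s k + certificate m s k ≡ recurrenceRight m s k + certificate m s (suc k)
  certificate-step m s k k≤m with m≤n⇒∃[o]m+o≡n k≤m
  ... | r , refl
    rewrite +-∸-assoc 1 (m≤m+n k r) | m+n∸m≡n k r
          | [1+n]Ck≡nCk+nC⁻k (suc (k + r + s)) k
          | pascal-+-suc r (k + r + s)
    = certificate-identity k r s ((r + p) C r) (suc p C k) (suc p C⁻ k) (suc (r + p) C suc r) ((r + suc p) C r) (4 ^ k)
        (subst (λ t → suc r * (t C suc r) ≡ suc p * ((r + suc p) C r)) (+-suc r p) ([1+k]*[k+c]C[1+k]≡c*[k+c]Ck r (suc p)))
        (subst (λ t → k * (t C k) ≡ suc (suc (r + s)) * (t C⁻ k)) (trans (+-suc k (r + s)) (cong suc (sym (+-assoc k r s)))) (k*[k+c]Ck≡[1+c]*[k+c]C⁻k k (suc (r + s))))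
    where
    p = k + r + s

  certificate-boundary : ∀ m s →
    certificate m s (suc m) + s * suc (suc (m + s)) * term (m + s) (suc m) (suc m)
    ≡ suc (m + s) * suc s * term (suc (m + s)) (suc m) (suc m)
  certificate-boundary m s
    rewrite n∸n≡0 m | sym (nCk+nC[k+1]≡[n+1]C[k+1] (suc (m + s)) m)
    = +-cancelʳ-≡ (F * (suc m * B)) _ _ (begin
        suc n * suc s * F * A * 1 + s * suc n * (F * 1 * B) + F * (suc m * B)
          ≡⟨ polynomial-identity m s F A B ⟩
        n * suc s * (F * 1 * (A + B)) + F * (suc s * A)
          ≡⟨ cong (λ t → n * suc s * (F * 1 * (A + B)) + F * t) hB ⟨
        n * suc s * (F * 1 * (A + B)) + F * (suc m * B) ∎)
    where
    n = suc (m + s)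
    F = 4 ^ suc m
    A = n C m
    B = n C suc m
    hB : suc m * B ≡ suc s * A
    hB = subst (λ t → suc m * (t C suc m) ≡ suc s * (t C m)) (+-suc m s) ([1+k]*[k+c]C[1+k]≡c*[k+c]Ck m (suc s))
    polynomial-identity : ∀ m s F A B →
      suc (suc (m + s)) * suc s * F * A * 1 + s * suc (suc (m + s)) * (F * 1 * B) + F * (suc m * B)
      ≡ suc (m + s) * suc s * (F * 1 * (A + B)) + F * (suc s * A)
    polynomial-identity = solve-∀

  -- The theorem at the paper's (j, m) = (2(m+1) + s, m+1), with the binomials multiplied in.
  D-recurrence : ∀ m s →
    4 * suc s * suc (suc (m + s)) * D (m + s) m + suc (suc s) * suc (m + s) * D (suc (m + s)) m
      + s * suc (suc (m + s)) * D (m + s) (suc m)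
    ≡ suc (m + s) * suc s * D (suc (m + s)) (suc m)
  D-recurrence m s = begin
    a * D p m + b * D n m + c * (Σ≤ m (term p (suc m)) + term p (suc m) (suc m))
      ≡⟨ split-last (a * D p m + b * D n m) c (Σ≤ m (term p (suc m))) (term p (suc m) (suc m)) ⟩
    a * D p m + b * D n m + c * Σ≤ m (term p (suc m)) + c * term p (suc m) (suc m)
      ≡⟨ cong (_+ c * term p (suc m) (suc m)) Σ≤-left ⟨
    Σ≤ m (recurrenceLeft m s) + c * term p (suc m) (suc m)
      ≡⟨ cong (λ t → t + c * term p (suc m) (suc m)) (+-identityʳ _) ⟨
    Σ≤ m (recurrenceLeft m s) + 0 + c * term p (suc m) (suc m)
      ≡⟨ cong (λ t → Σ≤ m (recurrenceLeft m s) + t + c * term p (suc m) (suc m)) certificate-at-0 ⟨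
    Σ≤ m (recurrenceLeft m s) + certificate m s 0 + c * term p (suc m) (suc m)
      ≡⟨ cong (_+ c * term p (suc m) (suc m)) (telescope m _ _ _ (certificate-step m s)) ⟩
    Σ≤ m (recurrenceRight m s) + certificate m s (suc m) + c * term p (suc m) (suc m)
      ≡⟨ +-assoc (Σ≤ m (recurrenceRight m s)) _ _ ⟩
    Σ≤ m (recurrenceRight m s) + (certificate m s (suc m) + c * term p (suc m) (suc m))
      ≡⟨ cong₂ _+_ (Σ≤-* m d (term n (suc m))) (certificate-boundary m s) ⟩
    d * Σ≤ m (term n (suc m)) + d * term n (suc m) (suc m)
      ≡⟨ *-distribˡ-+ d (Σ≤ m (term n (suc m))) (term n (suc m) (suc m)) ⟨
    d * D n (suc m) ∎
    where
    p = m + s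
    n = suc p
    a = 4 * suc s * suc n
    b = suc (suc s) * n
    c = s * suc n
    d = n * suc s
    split-last : ∀ x c u v → x + c * (u + v) ≡ x + c * u + c * v
    split-last = solve-∀
    Σ≤-left : Σ≤ m (recurrenceLeft m s) ≡ a * D p m + b * D n m + c * Σ≤ m (term p (suc m))
    Σ≤-left = trans (Σ≤-+ m _ _)
      (cong₂ _+_ (trans (Σ≤-+ m _ _) (cong₂ _+_ (Σ≤-* m a (term p m)) (Σ≤-* m b (term n m))))
                 (Σ≤-* m c (term p (suc m))))
    certificate-at-0 : certificate m s 0 ≡ 0
    certificate-at-0 = cong (_* ((suc m + p) C suc m)) (*-zeroʳ (suc n * suc s * 1))

  term-ratio : ∀ k r t → let m = suc (k + r) ; n = k + r + t in
    term n m (suc k) * (suc (r + n) * suc k) ≡ term n m k * (suc r * suc (r + t) * 4)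
  term-ratio k r t
    rewrite +-∸-assoc 1 (m≤m+n k r) | m+n∸m≡n k r
    = begin
      4 * F * X * Z * (suc (r + n) * suc k)   ≡⟨ regroup F X Z (suc (r + n)) (suc k) ⟩
      4 * F * (suc (r + n) * X) * (suc k * Z) ≡⟨ cong₂ (λ u v → 4 * F * u * v) hX (sym hZ) ⟨
      4 * F * (suc r * U) * (suc (r + t) * Y) ≡⟨ regroup′ F U Y (suc r) (suc (r + t)) ⟩
      F * U * Y * (suc r * suc (r + t) * 4)   ∎
    where
    n = k + r + t
    F = 4 ^ k
    X = (r + n) C r
    U = suc (r + n) C suc r
    Y = suc n C k
    Z = suc n C suc k
    hX : suc r * U ≡ suc (r + n) * X
    hX = [1+k]*[1+n]C[1+k]≡[1+n]*nCk (r + n) r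
    hZ : suc k * Z ≡ suc (r + t) * Y
    hZ = subst (λ x → suc k * (x C suc k) ≡ suc (r + t) * (x C k))
               (trans (+-suc k (r + t)) (cong suc (sym (+-assoc k r t))))
               ([1+k]*[k+c]C[1+k]≡c*[k+c]Ck k (suc (r + t)))
    regroup : ∀ F X Z a b → 4 * F * X * Z * (a * b) ≡ 4 * F * (a * X) * (b * Z)
    regroup = solve-∀
    regroup′ : ∀ F U Y a b → 4 * F * (a * U) * (b * Y) ≡ F * U * Y * (a * b * 4)
    regroup′ = solve-∀

module Pochhammer where
  open import Data.Nat as ℕ using (ℕ; zero; suc; _≤_; _!)
  import Data.Nat.Properties as ℕ
  open import Data.Nat.Combinatorics using (_C_)
  open import Data.Integer using (ℤ; +_; -[1+_]; -_; _+_; _-_; _*_; _^_; 1ℤ; NonZero)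
  import Data.Integer.Properties as ℤ
  open import Data.Integer.Tactic.RingSolver using (solve-∀)
  open import Data.Nat.Tactic.RingSolver using () renaming (solve-∀ to ℕ-solve-∀)
  open import Data.Product using (_,_)
  open import Relation.Binary.PropositionalEquality
  open ≡-Reasoning
  open Recurrence using (term; term-ratio)

  pochℤ : ℤ → ℕ → ℤ
  pochℤ a zero    = 1ℤ
  pochℤ a (suc k) = pochℤ a k * (a + + k)

  N≡k+x⇒-N+k≡-x : ∀ {N} k x → N ≡ k ℕ.+ x → - + N + + k ≡ - + x
  N≡k+x⇒-N+k≡-x {N} k x refl = begin
    - + (k ℕ.+ x) + + k   ≡⟨ cong (λ z → - z + + k) (ℤ.pos-+ k x) ⟩
    - (+ k + + x) + + k   ≡⟨ cancel (+ k) (+ x) ⟩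
    - + x                 ∎
    where
    cancel : ∀ a b → - (a + b) + a ≡ - b
    cancel = solve-∀

  N+1≡m+k+x⇒-N+m-1+k≡-x : ∀ {N} m k x → N ℕ.+ 1 ≡ m ℕ.+ k ℕ.+ x → - + N + + m - + 1 + + k ≡ - + x
  N+1≡m+k+x⇒-N+m-1+k≡-x {N} m k x eq = begin
    - + N + + m - + 1 + + k   ≡⟨ regroup (+ N) (+ m) (+ k) ⟩
    - (+ N + + 1) + (+ m + + k) ≡⟨ cong₂ (λ u v → - u + v) (ℤ.pos-+ N 1) (ℤ.pos-+ m k) ⟨
    - + (N ℕ.+ 1) + + (m ℕ.+ k) ≡⟨ N≡k+x⇒-N+k≡-x (m ℕ.+ k) x eq ⟩
    - + x                     ∎
    where
    regroup : ∀ N m k → - N + m - + 1 + k ≡ - (N + + 1) + (m + k)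
    regroup = solve-∀

  term-ratioℤ : ∀ k r t → let m = suc (k ℕ.+ r) ; n = k ℕ.+ r ℕ.+ t in
    + term n m (suc k) * ((- + (m ℕ.+ n) + + k) * + suc k)
    ≡ + term n m k * ((- + m + + k) * (- + (m ℕ.+ n) + + m - + 1 + + k) * -[1+ 3 ])
  term-ratioℤ k r t = begin
    + T′ * ((- + (m ℕ.+ n) + + k) * + suc k)
      ≡⟨ cong (λ z → + T′ * (z * + suc k)) (N≡k+x⇒-N+k≡-x k (suc (r ℕ.+ n)) m+n≡k+[1+r+n]) ⟩
    + T′ * (- + suc (r ℕ.+ n) * + suc k)
      ≡⟨ trans (move-sign (+ T′) (+ suc (r ℕ.+ n)) (+ suc k)) (cong -_ (sym (pos-*₃ T′ (suc (r ℕ.+ n)) (suc k)))) ⟩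
    - + (T′ ℕ.* (suc (r ℕ.+ n) ℕ.* suc k))
      ≡⟨ cong (λ z → - + z) (term-ratio k r t) ⟩
    - + (T ℕ.* (suc r ℕ.* suc (r ℕ.+ t) ℕ.* 4))
      ≡⟨ trans (cong -_ (pos-*₄ T (suc r) (suc (r ℕ.+ t)))) (move-signs (+ T) (+ suc r) (+ suc (r ℕ.+ t))) ⟩
    + T * (- + suc r * - + suc (r ℕ.+ t) * -[1+ 3 ])
      ≡⟨ cong₂ (λ u v → + T * (u * v * -[1+ 3 ]))
               (N≡k+x⇒-N+k≡-x k (suc r) (sym (ℕ.+-suc k r)))
               (N+1≡m+k+x⇒-N+m-1+k≡-x {m ℕ.+ n} m k (suc (r ℕ.+ t)) (m+n+1≡m+k+[1+r+t] k r t)) ⟨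
    + T * ((- + m + + k) * (- + (m ℕ.+ n) + + m - + 1 + + k) * -[1+ 3 ]) ∎
    where
    m = suc (k ℕ.+ r)
    n = k ℕ.+ r ℕ.+ t
    T = term n m k
    T′ = term n m (suc k)
    m+n≡k+[1+r+n] : m ℕ.+ n ≡ k ℕ.+ suc (r ℕ.+ n)
    m+n≡k+[1+r+n] = trans (cong suc (ℕ.+-assoc k r n)) (sym (ℕ.+-suc k (r ℕ.+ n)))
    m+n+1≡m+k+[1+r+t] : ∀ k r t → suc (k ℕ.+ r) ℕ.+ (k ℕ.+ r ℕ.+ t) ℕ.+ 1 ≡ suc (k ℕ.+ r) ℕ.+ k ℕ.+ suc (r ℕ.+ t)
    m+n+1≡m+k+[1+r+t] = ℕ-solve-∀
    pos-*₃ : ∀ a b c → + (a ℕ.* (b ℕ.* c)) ≡ + a * (+ b * + c)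
    pos-*₃ a b c = trans (ℤ.pos-* a (b ℕ.* c)) (cong (+ a *_) (ℤ.pos-* b c))
    pos-*₄ : ∀ a b c → + (a ℕ.* (b ℕ.* c ℕ.* 4)) ≡ + a * (+ b * + c * + 4)
    pos-*₄ a b c = trans (ℤ.pos-* a _) (cong (+ a *_) (trans (ℤ.pos-* (b ℕ.* c) 4) (cong (_* + 4) (ℤ.pos-* b c))))
    move-sign : ∀ x a b → x * (- a * b) ≡ - (x * (a * b))
    move-sign = solve-∀
    move-signs : ∀ x a b → - (x * (a * b * + 4)) ≡ x * (- a * - b * - + 4)
    move-signs = solve-∀

  -- C(m+n, m) times the k-th summand of d_{m+n,m}, with its denominator multiplied out.
  summand-cleared : ∀ n m k → k ≤ m → m ≤ suc n →
    + ((m ℕ.+ n) C m) * -[1+ 3 ] ^ k * (pochℤ (- + m) k * pochℤ (- + (m ℕ.+ n) + + m - + 1) k)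
    ≡ + term n m k * (pochℤ (- + (m ℕ.+ n)) k * + (k !))
  summand-cleared n m zero _ _ = begin
    + X * 1ℤ * (1ℤ * 1ℤ)  ≡⟨ drop-units (+ X) ⟩
    + X * (1ℤ * 1ℤ)       ≡⟨ cong (λ z → + z * (1ℤ * 1ℤ)) (trans (ℕ.*-identityʳ _) (ℕ.*-identityˡ X)) ⟨
    + (1 ℕ.* X ℕ.* 1) * (1ℤ * 1ℤ) ∎
    where
    X = (m ℕ.+ n) C m
    drop-units : ∀ x → x * 1ℤ * (1ℤ * 1ℤ) ≡ x * (1ℤ * 1ℤ)
    drop-units = solve-∀
  summand-cleared n m (suc k) k<m m≤1+n with ℕ.m≤n⇒∃[o]m+o≡n k<m
  ... | r , refl with ℕ.m≤n⇒∃[o]m+o≡n (ℕ.s≤s⁻¹ m≤1+n)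
  ... | t , refl = begin
    + X * (w * W) * ((Pa * (a + + k)) * (Pb * (b + + k)))
      ≡⟨ regroup₁ (+ X) w W Pa (a + + k) Pb (b + + k) ⟩
    + X * W * (Pa * Pb) * ((a + + k) * (b + + k) * w)
      ≡⟨ cong (_* ((a + + k) * (b + + k) * w)) (summand-cleared n m k (ℕ.m≤n⇒m≤1+n (ℕ.m≤m+n k r)) m≤1+n) ⟩
    + T * (Pc * + (k !)) * ((a + + k) * (b + + k) * w)
      ≡⟨ regroup₂ (+ T) (Pc * + (k !)) ((a + + k) * (b + + k) * w) ⟩
    Pc * + (k !) * (+ T * ((a + + k) * (b + + k) * w))
      ≡⟨ cong (Pc * + (k !) *_) (term-ratioℤ k r t) ⟨
    Pc * + (k !) * (+ T′ * ((c + + k) * + suc k))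
      ≡⟨ regroup₃ Pc (+ (k !)) (+ T′) (c + + k) (+ suc k) ⟩
    + T′ * (Pc * (c + + k) * (+ suc k * + (k !)))
      ≡⟨ cong (λ z → + T′ * (Pc * (c + + k) * z)) (ℤ.pos-* (suc k) (k !)) ⟨
    + T′ * (Pc * (c + + k) * + (suc k !)) ∎
    where
    X = (m ℕ.+ n) C m
    w = -[1+ 3 ]
    W = w ^ k
    a = - + m
    b = - + (m ℕ.+ n) + + m - + 1
    c = - + (m ℕ.+ n)
    Pa = pochℤ a k
    Pb = pochℤ b k
    Pc = pochℤ c k
    T = term n m k
    T′ = term n m (suc k)
    regroup₁ : ∀ x w W Pa a Pb b → x * (w * W) * ((Pa * a) * (Pb * b)) ≡ x * W * (Pa * Pb) * (a * b * w)
    regroup₁ = solve-∀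
    regroup₂ : ∀ x y z → x * y * z ≡ y * (x * z)
    regroup₂ = solve-∀
    regroup₃ : ∀ P f x c s → P * f * (x * (c * s)) ≡ x * (P * c * (s * f))
    regroup₃ = solve-∀

  pochℤ-nonZero : ∀ {N} k → k ≤ N → NonZero (pochℤ (- + N) k)
  pochℤ-nonZero zero    _   = _
  pochℤ-nonZero (suc k) k<N with ℕ.m≤n⇒∃[o]m+o≡n k<N
  ... | u , refl = ℤ.i*j≢0 (pochℤ (- + suc (k ℕ.+ u)) k) (- + suc (k ℕ.+ u) + + k) {{pochℤ-nonZero k (ℕ.m≤n⇒m≤1+n (ℕ.m≤m+n k u))}}
                              {{subst NonZero (sym (N≡k+x⇒-N+k≡-x k (suc u) (sym (ℕ.+-suc k u)))) _}}

open import Defs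
open import Data.Nat using (ℕ; _≤_; _∸_)
open import Data.Nat.DivMod using (_/_)
open import Data.Nat.Combinatorics using (_C_)
open import Data.Integer using (+_)
import Data.Integer as ℤ
import Data.Nat as ℕ
open import Data.Rational using (ℚ; 0ℚ; _+_; _*_; _-_)
open import Relation.Binary.PropositionalEquality using (_≡_)

open import Data.Empty using (⊥-elim)
open import Data.Product using (∃₂; _×_; _,_)
open import Relation.Binary.PropositionalEquality using (_≢_; refl; sym; trans; cong; cong₂; module ≡-Reasoning)
open import Relation.Nullary using (yes; no)
import Data.Nat.Properties as ℕ
import Data.Nat.DivMod as ℕ
import Data.Integer.Properties as ℤ
import Data.Rational as ℚ
import Data.Rational.Properties as ℚ
import Data.Rational.Unnormalised as ℚᵘ
open import Data.Rational.Unnormalised using (mkℚᵘ; *≡*)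
import Data.Rational.Unnormalised.Properties as ℚᵘ
open import Data.Rational.Solver using (module +-*-Solver)
import Data.Nat.Tactic.RingSolver as NT
import Data.Integer.Tactic.RingSolver as ZT
open Recurrence using (Σ≤; term; D; D-recurrence)
open Pochhammer using (pochℤ; summand-cleared; pochℤ-nonZero)

ℤ→ℚ-+ : ∀ a b → ℤ→ℚ (a ℤ.+ b) ≡ ℤ→ℚ a + ℤ→ℚ b
ℤ→ℚ-+ a b = trans (ℚ.fromℚᵘ-cong (begin
  mkℚᵘ (a ℤ.+ b) 0                          ≈⟨ *≡* (cong (ℤ._* + 1) (cong₂ ℤ._+_ (ℤ.*-identityʳ a) (ℤ.*-identityʳ b))) ⟨
  mkℚᵘ a 0 ℚᵘ.+ mkℚᵘ b 0                    ≈⟨ ℚᵘ.+-cong (ℚ.toℚᵘ-fromℚᵘ (mkℚᵘ a 0)) (ℚ.toℚᵘ-fromℚᵘ (mkℚᵘ b 0)) ⟨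
  ℚ.toℚᵘ (ℤ→ℚ a) ℚᵘ.+ ℚ.toℚᵘ (ℤ→ℚ b)        ≈⟨ ℚ.toℚᵘ-homo-+ (ℤ→ℚ a) (ℤ→ℚ b) ⟨
  ℚ.toℚᵘ (ℤ→ℚ a + ℤ→ℚ b)                    ∎)) (ℚ.fromℚᵘ-toℚᵘ _)
  where open ℚᵘ.≃-Reasoning

ℤ→ℚ-* : ∀ a b → ℤ→ℚ (a ℤ.* b) ≡ ℤ→ℚ a * ℤ→ℚ b
ℤ→ℚ-* a b = trans (ℚ.fromℚᵘ-cong (begin
  mkℚᵘ (a ℤ.* b) 0                          ≈⟨ ℚᵘ.*-cong (ℚ.toℚᵘ-fromℚᵘ (mkℚᵘ a 0)) (ℚ.toℚᵘ-fromℚᵘ (mkℚᵘ b 0)) ⟨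
  ℚ.toℚᵘ (ℤ→ℚ a) ℚᵘ.* ℚ.toℚᵘ (ℤ→ℚ b)        ≈⟨ ℚ.toℚᵘ-homo-* (ℤ→ℚ a) (ℤ→ℚ b) ⟨
  ℚ.toℚᵘ (ℤ→ℚ a * ℤ→ℚ b)                    ∎)) (ℚ.fromℚᵘ-toℚᵘ _)
  where open ℚᵘ.≃-Reasoning

ℤ→ℚ-≢0 : ∀ z .{{_ : ℤ.NonZero z}} → ℤ→ℚ z ≢ 0ℚ
ℤ→ℚ-≢0 z eq = ℕ.≢-nonZero⁻¹ ℤ.∣ z ∣ (cong ℤ.∣_∣ z≡0)
  where
  z≡0 : z ≡ + 0
  z≡0 = ℚᵘ.p≃0⇒↥p≡0 (mkℚᵘ z 0) (ℚᵘ.≃-trans (ℚᵘ.≃-sym (ℚ.toℚᵘ-fromℚᵘ (mkℚᵘ z 0))) (ℚᵘ.≃-reflexive (cong ℚ.toℚᵘ eq)))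

ℕ→ℚ-+ : ∀ a b → ℕ→ℚ (a ℕ.+ b) ≡ ℕ→ℚ a + ℕ→ℚ b
ℕ→ℚ-+ a b = trans (cong ℤ→ℚ (ℤ.pos-+ a b)) (ℤ→ℚ-+ (+ a) (+ b))

ℕ→ℚ-* : ∀ a b → ℕ→ℚ (a ℕ.* b) ≡ ℕ→ℚ a * ℕ→ℚ b
ℕ→ℚ-* a b = trans (cong ℤ→ℚ (ℤ.pos-* a b)) (ℤ→ℚ-* (+ a) (+ b))

poch-ℤ→ℚ : ∀ a k → poch (ℤ→ℚ a) k ≡ ℤ→ℚ (pochℤ a k)
poch-ℤ→ℚ a ℕ.zero    = refl
poch-ℤ→ℚ a (ℕ.suc k) = trans (cong₂ _*_ (poch-ℤ→ℚ a k) (sym (ℤ→ℚ-+ a (+ k)))) (sym (ℤ→ℚ-* (pochℤ a k) _))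

fact-ℤ→ℚ : ∀ k → fact k ≡ ℤ→ℚ (+ (k ℕ.!))
fact-ℤ→ℚ ℕ.zero    = refl
fact-ℤ→ℚ (ℕ.suc k) = begin
  fact k * ℕ→ℚ (ℕ.suc k)           ≡⟨ cong (_* ℕ→ℚ (ℕ.suc k)) (fact-ℤ→ℚ k) ⟩
  ℕ→ℚ (k ℕ.!) * ℕ→ℚ (ℕ.suc k)      ≡⟨ ℕ→ℚ-* (k ℕ.!) (ℕ.suc k) ⟨
  ℕ→ℚ (k ℕ.! ℕ.* ℕ.suc k)          ≡⟨ cong ℕ→ℚ (ℕ.*-comm (k ℕ.!) (ℕ.suc k)) ⟩
  ℕ→ℚ (ℕ.suc k ℕ.!)                ∎
  where open ≡-Reasoning

^'-ℤ→ℚ : ∀ a k → ℤ→ℚ a ^' k ≡ ℤ→ℚ (a ℤ.^ k)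
^'-ℤ→ℚ a ℕ.zero    = refl
^'-ℤ→ℚ a (ℕ.suc k) = begin
  ℤ→ℚ a ^' k * ℤ→ℚ a           ≡⟨ cong (_* ℤ→ℚ a) (^'-ℤ→ℚ a k) ⟩
  ℤ→ℚ (a ℤ.^ k) * ℤ→ℚ a        ≡⟨ ℤ→ℚ-* (a ℤ.^ k) a ⟨
  ℤ→ℚ (a ℤ.^ k ℤ.* a)          ≡⟨ cong ℤ→ℚ (ℤ.*-comm (a ℤ.^ k) a) ⟩
  ℤ→ℚ (a ℤ.^ ℕ.suc k)          ∎
  where open ≡-Reasoning

÷'≡÷ : ∀ x q .{{_ : ℚ.NonZero q}} → x ÷' q ≡ x ℚ.÷ q
÷'≡÷ x q with q ℚ.≟ 0ℚ
... | yes refl = ⊥-elim (ℕ.≢-nonZero⁻¹ 0 refl)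
... | no  _    = refl

ℤ→ℚ-quotient : ∀ X P Q Z T .{{_ : ℤ.NonZero Q}} → X ℤ.* Z ℤ.* P ≡ T ℤ.* Q →
                ℤ→ℚ X * ((ℤ→ℚ P ÷' ℤ→ℚ Q) * ℤ→ℚ Z) ≡ ℤ→ℚ T
ℤ→ℚ-quotient X P Q Z T eq = begin
  x * ((p ÷' q) * z)          ≡⟨ cong (λ y → x * (y * z)) (÷'≡÷ p q) ⟩
  x * ((p * ℚ.1/ q) * z)      ≡⟨ regroup x p z (ℚ.1/ q) ⟩
  x * z * p * ℚ.1/ q          ≡⟨ cong (_* ℚ.1/ q) (trans (sym (trans (ℤ→ℚ-* (X ℤ.* Z) P) (cong (_* p) (ℤ→ℚ-* X Z)))) (trans (cong ℤ→ℚ eq) (ℤ→ℚ-* T Q))) ⟩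
  t * q * ℚ.1/ q              ≡⟨ ℚ.*-assoc t q (ℚ.1/ q) ⟩
  t * (q * ℚ.1/ q)            ≡⟨ cong (t *_) (ℚ.*-inverseʳ q) ⟩
  t * ℚ.1ℚ                    ≡⟨ ℚ.*-identityʳ t ⟩
  t                           ∎
  where
  open ≡-Reasoning
  x = ℤ→ℚ X ; p = ℤ→ℚ P ; q = ℤ→ℚ Q ; z = ℤ→ℚ Z ; t = ℤ→ℚ T
  instance
    q-nonZero : ℚ.NonZero q
    q-nonZero = ℚ.≢-nonZero (ℤ→ℚ-≢0 Q)
  regroup : ∀ x p z r → x * ((p * r) * z) ≡ x * z * p * r
  regroup = solve 4 (λ x p z r → x :* ((p :* r) :* z) := x :* z :* p :* r) refl
    where open +-*-Solver

sumTo-*ˡ : ∀ c m f → c * sumTo m f ≡ sumTo m (λ k → c * f k)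
sumTo-*ˡ c ℕ.zero    f = refl
sumTo-*ˡ c (ℕ.suc m) f = trans (ℚ.*-distribˡ-+ c (sumTo m f) (f (ℕ.suc m))) (cong (_+ c * f (ℕ.suc m)) (sumTo-*ˡ c m f))

sumTo-cong : ∀ m {f g} → (∀ k → k ≤ m → f k ≡ g k) → sumTo m f ≡ sumTo m g
sumTo-cong ℕ.zero    f≡g = f≡g 0 ℕ.z≤n
sumTo-cong (ℕ.suc m) f≡g = cong₂ _+_ (sumTo-cong m (λ k k≤m → f≡g k (ℕ.m≤n⇒m≤1+n k≤m))) (f≡g (ℕ.suc m) ℕ.≤-refl)

sumTo-ℕ→ℚ : ∀ m f → sumTo m (λ k → ℕ→ℚ (f k)) ≡ ℕ→ℚ (Σ≤ m f)
sumTo-ℕ→ℚ ℕ.zero    f = refl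
sumTo-ℕ→ℚ (ℕ.suc m) f = trans (cong (_+ ℕ→ℚ (f (ℕ.suc m))) (sumTo-ℕ→ℚ m f)) (sym (ℕ→ℚ-+ (Σ≤ m f) (f (ℕ.suc m))))

binomial*d≡D : ∀ {j} n m → j ≡ m ℕ.+ n → m ≤ ℕ.suc n → ℕ→ℚ (j C m) * d j m ≡ ℕ→ℚ (D n m)
binomial*d≡D n m refl m≤1+n = begin
  ℕ→ℚ X * sumTo m summand                 ≡⟨ sumTo-*ˡ (ℕ→ℚ X) m summand ⟩
  sumTo m (λ k → ℕ→ℚ X * summand k)       ≡⟨ sumTo-cong m scaled-summand ⟩
  sumTo m (λ k → ℕ→ℚ (term n m k))        ≡⟨ sumTo-ℕ→ℚ m (term n m) ⟩
  ℕ→ℚ (D n m)                             ∎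
  where
  open ≡-Reasoning
  X = (m ℕ.+ n) C m
  a b c : ℤ.ℤ
  a = ℤ.- (+ m)
  b = ℤ.- (+ (m ℕ.+ n)) ℤ.+ + m ℤ.- + 1
  c = ℤ.- (+ (m ℕ.+ n))
  summand : ℕ → ℚ
  summand k = ((poch (ℤ→ℚ a) k * poch (ℤ→ℚ b) k) ÷' (poch (ℤ→ℚ c) k * fact k)) * (ℤ→ℚ ℤ.-[1+ 3 ] ^' k)
  summand-ℤ→ℚ : ∀ k → summand k ≡ (ℤ→ℚ (pochℤ a k ℤ.* pochℤ b k) ÷' ℤ→ℚ (pochℤ c k ℤ.* + (k ℕ.!))) * ℤ→ℚ (ℤ.-[1+ 3 ] ℤ.^ k)
  summand-ℤ→ℚ k = cong₂ _*_
    (cong₂ _÷'_ (trans (cong₂ _*_ (poch-ℤ→ℚ a k) (poch-ℤ→ℚ b k)) (sym (ℤ→ℚ-* (pochℤ a k) (pochℤ b k))))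
                (trans (cong₂ _*_ (poch-ℤ→ℚ c k) (fact-ℤ→ℚ k)) (sym (ℤ→ℚ-* (pochℤ c k) (+ (k ℕ.!))))))
    (^'-ℤ→ℚ ℤ.-[1+ 3 ] k)
  scaled-summand : ∀ k → k ≤ m → ℕ→ℚ X * summand k ≡ ℕ→ℚ (term n m k)
  scaled-summand k k≤m = trans (cong (ℕ→ℚ X *_) (summand-ℤ→ℚ k))
    (ℤ→ℚ-quotient (+ X) _ _ _ (+ term n m k)
       {{ℤ.i*j≢0 (pochℤ c k) (+ (k ℕ.!)) {{pochℤ-nonZero k (ℕ.≤-trans k≤m (ℕ.m≤m+n m n))}} {{k ℕ.!≢0}}}}
       (summand-cleared n m k k≤m m≤1+n))

D-recurrenceℚ : ∀ m s → let p = m ℕ.+ s ; n = ℕ.suc p in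
  ℕ→ℚ 4 * ℕ→ℚ (ℕ.suc s) * ℕ→ℚ (ℕ.suc n) * ℕ→ℚ (D p m) + ℕ→ℚ (2 ℕ.+ s) * ℕ→ℚ n * ℕ→ℚ (D n m)
    + ℕ→ℚ s * ℕ→ℚ (ℕ.suc n) * ℕ→ℚ (D p (ℕ.suc m))
  ≡ ℕ→ℚ n * ℕ→ℚ (ℕ.suc s) * ℕ→ℚ (D n (ℕ.suc m))
D-recurrenceℚ m s = begin
  ℕ→ℚ 4 * ℕ→ℚ (ℕ.suc s) * ℕ→ℚ (ℕ.suc n) * ℕ→ℚ (D p m) + ℕ→ℚ (2 ℕ.+ s) * ℕ→ℚ n * ℕ→ℚ (D n m)
    + ℕ→ℚ s * ℕ→ℚ (ℕ.suc n) * ℕ→ℚ (D p (ℕ.suc m))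
    ≡⟨ cong₂ _+_ (cong₂ _+_ (ℕ→ℚ-*₄ 4 (ℕ.suc s) (ℕ.suc n) (D p m)) (ℕ→ℚ-*₃ (2 ℕ.+ s) n (D n m)))
                 (ℕ→ℚ-*₃ s (ℕ.suc n) (D p (ℕ.suc m))) ⟨
  ℕ→ℚ x₁ + ℕ→ℚ x₂ + ℕ→ℚ x₃
    ≡⟨ trans (ℕ→ℚ-+ (x₁ ℕ.+ x₂) x₃) (cong (_+ ℕ→ℚ x₃) (ℕ→ℚ-+ x₁ x₂)) ⟨
  ℕ→ℚ (x₁ ℕ.+ x₂ ℕ.+ x₃)
    ≡⟨ cong ℕ→ℚ (D-recurrence m s) ⟩
  ℕ→ℚ (n ℕ.* ℕ.suc s ℕ.* D n (ℕ.suc m))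
    ≡⟨ ℕ→ℚ-*₃ n (ℕ.suc s) (D n (ℕ.suc m)) ⟩
  ℕ→ℚ n * ℕ→ℚ (ℕ.suc s) * ℕ→ℚ (D n (ℕ.suc m)) ∎
  where
  open ≡-Reasoning
  p = m ℕ.+ s
  n = ℕ.suc p
  x₁ = 4 ℕ.* ℕ.suc s ℕ.* ℕ.suc n ℕ.* D p m
  x₂ = ℕ.suc (ℕ.suc s) ℕ.* n ℕ.* D n m
  x₃ = s ℕ.* ℕ.suc n ℕ.* D p (ℕ.suc m)
  ℕ→ℚ-*₃ : ∀ a b c → ℕ→ℚ (a ℕ.* b ℕ.* c) ≡ ℕ→ℚ a * ℕ→ℚ b * ℕ→ℚ c
  ℕ→ℚ-*₃ a b c = trans (ℕ→ℚ-* (a ℕ.* b) c) (cong (_* ℕ→ℚ c) (ℕ→ℚ-* a b))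
  ℕ→ℚ-*₄ : ∀ a b c e → ℕ→ℚ (a ℕ.* b ℕ.* c ℕ.* e) ≡ ℕ→ℚ a * ℕ→ℚ b * ℕ→ℚ c * ℕ→ℚ e
  ℕ→ℚ-*₄ a b c e = trans (ℕ→ℚ-* (a ℕ.* b ℕ.* c) e) (cong (_* ℕ→ℚ e) (ℕ→ℚ-*₃ a b c))

-- The first nine arguments are explicit: unification cannot recover them through ℚ's computing _*_.
combination≡0 : ∀ four a₁ u₁ a₂ u₂ a₃ u₃ a₄ u₄ {z₁ z₂ z₃ z₄ z₅ y₁ y₂ y₃ y₄ y₅ e₁ e₂ e₃ e₄ : ℚ} →
  z₁ ≡ y₁ → z₂ ≡ y₂ → z₃ ≡ y₃ → z₄ ≡ y₄ → z₅ ≡ y₅ →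
  a₁ * u₁ ≡ e₁ → a₂ * u₂ ≡ e₂ → a₃ * u₃ ≡ e₃ → a₄ * u₄ ≡ e₄ →
  four * y₁ * y₂ * e₁ + y₃ * y₄ * e₂ + y₅ * y₂ * e₃ ≡ y₄ * y₁ * e₄ →
  four * a₁ * z₁ * z₂ * u₁ + a₂ * z₃ * z₄ * u₂ + a₃ * z₅ * z₂ * u₃ - a₄ * z₄ * z₁ * u₄ ≡ 0ℚ
combination≡0 four a₁ u₁ a₂ u₂ a₃ u₃ a₄ u₄ {z₁} {z₂} {z₃} {z₄} {z₅}
  refl refl refl refl refl refl refl refl refl relation = begin
  four * a₁ * z₁ * z₂ * u₁ + a₂ * z₃ * z₄ * u₂ + a₃ * z₅ * z₂ * u₃ - a₄ * z₄ * z₁ * u₄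
    ≡⟨ regroup four a₁ u₁ a₂ u₂ a₃ u₃ a₄ u₄ z₁ z₂ z₃ z₄ z₅ ⟩
  four * z₁ * z₂ * (a₁ * u₁) + z₃ * z₄ * (a₂ * u₂) + z₅ * z₂ * (a₃ * u₃) - z₄ * z₁ * (a₄ * u₄)
    ≡⟨ cong (_- z₄ * z₁ * (a₄ * u₄)) relation ⟩
  z₄ * z₁ * (a₄ * u₄) - z₄ * z₁ * (a₄ * u₄)
    ≡⟨ ℚ.+-inverseʳ (z₄ * z₁ * (a₄ * u₄)) ⟩
  0ℚ ∎
  where
  open ≡-Reasoning
  regroup : ∀ four a₁ u₁ a₂ u₂ a₃ u₃ a₄ u₄ z₁ z₂ z₃ z₄ z₅ →
    four * a₁ * z₁ * z₂ * u₁ + a₂ * z₃ * z₄ * u₂ + a₃ * z₅ * z₂ * u₃ - a₄ * z₄ * z₁ * u₄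
    ≡ four * z₁ * z₂ * (a₁ * u₁) + z₃ * z₄ * (a₂ * u₂) + z₅ * z₂ * (a₃ * u₃) - z₄ * z₁ * (a₄ * u₄)
  regroup = solve 14 (λ four a₁ u₁ a₂ u₂ a₃ u₃ a₄ u₄ z₁ z₂ z₃ z₄ z₅ →
    four :* a₁ :* z₁ :* z₂ :* u₁ :+ a₂ :* z₃ :* z₄ :* u₂ :+ a₃ :* z₅ :* z₂ :* u₃ :- a₄ :* z₄ :* z₁ :* u₄
    := four :* z₁ :* z₂ :* (a₁ :* u₁) :+ z₃ :* z₄ :* (a₂ :* u₂) :+ z₅ :* z₂ :* (a₃ :* u₃) :- z₄ :* z₁ :* (a₄ :* u₄)) refl
    where open +-*-Solver

+j-+a≡+b : ∀ {j} a b → j ≡ a ℕ.+ b → + j ℤ.- + a ≡ + b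
+j-+a≡+b a b refl = trans (cong (ℤ._- + a) (ℤ.pos-+ a b)) (cancel (+ a) (+ b))
  where
  cancel : ∀ x y → x ℤ.+ y ℤ.- x ≡ y
  cancel = ZT.solve-∀

+j-+a++c≡+[c+b] : ∀ {j} a b c → j ≡ a ℕ.+ b → + j ℤ.- + a ℤ.+ + c ≡ + (c ℕ.+ b)
+j-+a++c≡+[c+b] a b c j≡a+b =
  trans (cong (ℤ._+ + c) (+j-+a≡+b a b j≡a+b)) (trans (ℤ.+-comm (+ b) (+ c)) (sym (ℤ.pos-+ c b)))

[1+m]+[1+m+s]≡2[1+m]+s : ∀ m s → ℕ.suc m ℕ.+ ℕ.suc (m ℕ.+ s) ≡ 2 ℕ.* ℕ.suc m ℕ.+ s
[1+m]+[1+m+s]≡2[1+m]+s = NT.solve-∀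

split-indices : ∀ j m → 1 ≤ m → m ≤ j / 2 → ∃₂ λ m′ s → m ≡ ℕ.suc m′ × j ≡ ℕ.suc m′ ℕ.+ ℕ.suc (m′ ℕ.+ s)
split-indices j (ℕ.suc m′) _ m≤j/2 =
  m′ , j ∸ 2 ℕ.* ℕ.suc m′ , refl , trans (sym (ℕ.m+[n∸m]≡n 2m≤j)) (sym ([1+m]+[1+m+s]≡2[1+m]+s m′ (j ∸ 2 ℕ.* ℕ.suc m′)))
  where
  2m≤j : 2 ℕ.* ℕ.suc m′ ≤ j
  2m≤j = ℕ.≤-trans (ℕ.≤-reflexive (ℕ.*-comm 2 (ℕ.suc m′)))
                   (ℕ.≤-trans (ℕ.*-monoˡ-≤ 2 m≤j/2) (ℕ.m/n*n≤m j 2))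

lemma1 : (j m : ℕ) → 2 ≤ j → 1 ≤ m → m ≤ j / 2 →
    ((ℕ→ℚ 4 * ℕ→ℚ ((j ∸ 2) C (m ∸ 1)) * ℤ→ℚ (+ j ℤ.- + (2 ℕ.* m) ℤ.+ + 1) * ℤ→ℚ (+ j ℤ.- + m ℤ.+ + 1) * d (j ∸ 2) (m ∸ 1)
      + ℕ→ℚ ((j ∸ 1) C (m ∸ 1)) * ℤ→ℚ (+ j ℤ.- + (2 ℕ.* m) ℤ.+ + 2) * ℤ→ℚ (+ j ℤ.- + m) * d (j ∸ 1) (m ∸ 1))
      + ℕ→ℚ ((j ∸ 1) C m) * ℤ→ℚ (+ j ℤ.- + (2 ℕ.* m)) * ℤ→ℚ (+ j ℤ.- + m ℤ.+ + 1) * d (j ∸ 1) m)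
      - ℕ→ℚ (j C m) * ℤ→ℚ (+ j ℤ.- + m) * ℤ→ℚ (+ j ℤ.- + (2 ℕ.* m) ℤ.+ + 1) * d j m
      ≡ 0ℚ
lemma1 j m _ 1≤m m≤j/2 with split-indices j m 1≤m m≤j/2
... | m′ , s , refl , refl = combination≡0 (ℕ→ℚ 4)
  (ℕ→ℚ ((J ∸ 2) C m′)) (d (J ∸ 2) m′) (ℕ→ℚ ((J ∸ 1) C m′)) (d (J ∸ 1) m′)
  (ℕ→ℚ ((J ∸ 1) C M)) (d (J ∸ 1) M) (ℕ→ℚ (J C M)) (d J M)
  (cong ℤ→ℚ (+j-+a++c≡+[c+b] (2 ℕ.* M) s 1 j≡2m+s)) (cong ℤ→ℚ (+j-+a++c≡+[c+b] M n 1 refl))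
  (cong ℤ→ℚ (+j-+a++c≡+[c+b] (2 ℕ.* M) s 2 j≡2m+s)) (cong ℤ→ℚ (+j-+a≡+b M n refl))
  (cong ℤ→ℚ (+j-+a≡+b (2 ℕ.* M) s j≡2m+s))
  (binomial*d≡D p m′ (cong (_∸ 1) (ℕ.+-suc m′ p)) (ℕ.m≤n⇒m≤1+n (ℕ.m≤m+n m′ s)))
  (binomial*d≡D n m′ refl (ℕ.m≤n⇒m≤1+n (ℕ.m≤n⇒m≤1+n (ℕ.m≤m+n m′ s))))
  (binomial*d≡D p (ℕ.suc m′) (ℕ.+-suc m′ p) (ℕ.s≤s (ℕ.m≤m+n m′ s)))
  (binomial*d≡D n (ℕ.suc m′) refl (ℕ.m≤n⇒m≤1+n (ℕ.s≤s (ℕ.m≤m+n m′ s))))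
  (D-recurrenceℚ m′ s)
  where
  M = ℕ.suc m′
  p = m′ ℕ.+ s
  n = ℕ.suc p
  J = M ℕ.+ n
  j≡2m+s = [1+m]+[1+m+s]≡2[1+m]+s m′ s
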